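{- Let $n\ge 1$ and let $\mathcal{P}(n-1,1,2)$ be the set of lattice paths with steps $(1,1)$ (up) and $(1,-1)$ (down) from $(0,0)$ to $(2n,2)$. Then: (1) for $k>1$ and each $j=1,\dots,k-1$, the number of paths in $\mathcal{P}(n-1,1,2)$ that start with a down step, have exactly $k-1$ even down steps, and have exactly $j$ even down steps starting on or below the $x$-axis, is $\frac{1}{k-1}\binom{n}{k}\binom{n-1}{k-2}$; (2) for $k\ge1$ and each $j=1,\dots,k$, the number of paths in $\mathcal{P}(n-1,1,2)$ that start with an up step, have exactly $k$ even up steps, and have exactly $j$ even up steps starting on or below the $x$-axis, is $\frac{1}{k}\binom{n-1}{k-1}\binom{n}{k-1}$.
   Context: The steps of a path in $\mathcal{P}(n-1,1,2)$ occupy positions $0,1,\dots,2n-1$, the position of a step being the $x$-coordinate of its initial vertex. An even up (resp. down) step is an up (resp. down) step in an even position. A step starts on or below the $x$-axis if its initial vertex has $y$-coordinate $\le 0$. -}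

module Defs where

open import Data.Bool using (Bool; true; false; if_then_else_; _∧_; not)
open import Data.Nat using (ℕ; zero; suc; _+_; _*_)
open import Data.Integer using (ℤ; +_; _≤ᵇ_) renaming (_+_ to _+ℤ_)
open import Data.Vec using (Vec; []; _∷_)
open import Data.List using (List; []; _∷_; map; _++_; filterᵇ; length)
open import Relation.Nullary.Decidable using (⌊_⌋)

isEven : ℕ → Bool
isEven zero = true
isEven (suc m) = not (isEven m)

-- A step: true = up step (1,1), false = down step (1,-1).
-- A path of length m is a Vec Bool m; step i occupies position i (x-coordinate of its start).

allWords : (m : ℕ) → List (Vec Bool m)
allWords zero = [] ∷ []
allWords (suc m) = map (true ∷_) (allWords m) ++ map (false ∷_) (allWords m)

stepℤ : Bool → ℤ
stepℤ true = + 1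
stepℤ false = Data.Integer.-[1+ 0 ]

endHeight : ∀ {m} → ℤ → Vec Bool m → ℤ
endHeight h [] = h
endHeight h (b ∷ v) = endHeight (h +ℤ stepℤ b) v

inP : (n : ℕ) → Vec Bool (2 * n) → Bool
inP n v = ⌊ Data.Integer._≟_ (endHeight (+ 0) v) (+ 2) ⌋

-- number of steps of kind b at even position whose initial vertex has height ≤ 0
-- (when onlyLow = true), or all steps of kind b at even position (onlyLow = false).
-- arguments: current position, current height.
countEven : ∀ {m} → Bool → Bool → ℕ → ℤ → Vec Bool m → ℕ
countEven b onlyLow pos h [] = 0
countEven b onlyLow pos h (s ∷ v) =
  (if ⌊ Data.Bool._≟_ s b ⌋ ∧ isEven pos ∧ (if onlyLow then (h ≤ᵇ + 0) else true)
   then 1 else 0)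
  + countEven b onlyLow (suc pos) (h +ℤ stepℤ s) v

evenSteps : ∀ {m} → Bool → Vec Bool m → ℕ
evenSteps b v = countEven b false 0 (+ 0) v

evenStepsLow : ∀ {m} → Bool → Vec Bool m → ℕ
evenStepsLow b v = countEven b true 0 (+ 0) v

countPaths : (n : ℕ) → Bool → ℕ → ℕ → ℕ
countPaths n b e j =
  length (filterᵇ (λ v → inP n v
                         ∧ startsWith v
                         ∧ ⌊ evenSteps b v Data.Nat.≟ e ⌋
                         ∧ ⌊ evenStepsLow b v Data.Nat.≟ j ⌋)
                  (allWords (2 * n)))
  where
  startsWith : ∀ {m} → Vec Bool m → Bool
  startsWith [] = false
  startsWith (s ∷ _) = ⌊ Data.Bool._≟_ s b ⌋

module Submission where

-- Pairing the steps at positions 2i and 2i+1 turns a path of length 2n into a word of n double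
-- steps; at even positions the half-height changes by +1 (UU), 0 (UD, DU) or -1 (DD), so the paths
-- of P(n-1,1,2) become the words ending at half-height 1, and the even b-steps are the double
-- steps whose first step is b. Cycle lemma: a word ending at height 1 with e such double steps has
-- n rotations, and those starting with b have 1, 2, ..., e low even b-steps, each value exactly once,
-- because the low b-steps of the rotation at r are the b-steps whose (height, position) key is at
-- most that of r in a suitable total order. Hence n times the count equals the number of words
-- ending at height 1 with e double steps starting with b. As the final half-height is
-- #(first step up) - #(second step down), that number is a product of two binomial coefficients,
-- and k C(n,k) = n C(n-1,k-1) finishes the computation.

open import Defs
open import Data.Bool using (Bool; true; false; T; not; _∧_; if_then_else_)
open import Data.Bool.Properties using (T-∧; ∧-identityʳ; ∧-zeroʳ)
import Data.Bool as Bool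
open import Data.Empty using (⊥-elim)
open import Data.Integer as ℤ using (ℤ; +_; -[1+_])
import Data.Integer.Properties as ℤ
import Data.Integer.Tactic.RingSolver as ℤ-Solver
open import Data.List using (List; []; _∷_; _++_; length; take; drop; map; filterᵇ)
open import Data.List.Properties using (++-assoc; ++-identityʳ; take++drop≡id; length-take)
open import Data.Nat using (ℕ; zero; suc; _+_; _*_; _∸_; _≤_; _<_; z≤n; s≤s; _≟_; NonZero)
import Data.Nat.Properties as ℕ
open import Algebra.Properties.CommutativeSemigroup ℕ.*-commutativeSemigroup using (x∙yz≈y∙xz)
open import Data.Nat.Combinatorics using (_C_; nC1≡n; nCk+nC[k+1]≡[n+1]C[k+1])
open import Data.Nat.Tactic.RingSolver using (solve-∀)
open import Data.Product using (_×_; _,_; proj₁; proj₂)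
open import Data.Product.Relation.Binary.Lex.NonStrict using (×-Lex; ×-isDecTotalOrder)
open import Data.Product.Relation.Binary.Pointwise.NonDependent using (Pointwise)
open import Data.Sum using (inj₁; inj₂)
open import Data.Vec using (Vec; []; _∷_; toList)
open import Function using (_∘_; flip; _⇔_; mk⇔; Equivalence)
import Function.Properties.Equivalence as ⇔
open import Relation.Binary using (Rel; IsDecTotalOrder)
import Relation.Binary.Construct.Flip.EqAndOrd as Flip
open import Relation.Binary.PropositionalEquality
open import Relation.Nullary using (¬_; Dec; yes; no)
open import Relation.Nullary.Decidable using (⌊_⌋; does-⇔; isYes≗does; T?; toWitness; fromWitness)

𝟙 : Bool → ℕ
𝟙 b = if b then 1 else 0

𝟙≤1 : ∀ b → 𝟙 b ≤ 1
𝟙≤1 true  = s≤s z≤n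
𝟙≤1 false = z≤n

1≤𝟙 : ∀ {b} → T b → 1 ≤ 𝟙 b
1≤𝟙 {true} _ = s≤s z≤n

𝟙-∧-≤ : ∀ x y → 𝟙 (x ∧ y) ≤ 𝟙 x
𝟙-∧-≤ false y = z≤n
𝟙-∧-≤ true  y = 𝟙≤1 y

𝟙-∧-< : ∀ {x} → T x → 𝟙 (x ∧ false) < 𝟙 (x ∧ true)
𝟙-∧-< {true} _ = s≤s z≤n

𝟙-∧-mono : ∀ x {y y'} → (T y → T y') → 𝟙 (x ∧ y) ≤ 𝟙 (x ∧ y')
𝟙-∧-mono false f = z≤n
𝟙-∧-mono true {false} f = z≤n
𝟙-∧-mono true {true} {true} f = s≤s z≤n
𝟙-∧-mono true {true} {false} f = ⊥-elim (f _)

⌊⌋-⇔ : ∀ {a b} {A : Set a} {B : Set b} → A ⇔ B → (a? : Dec A) (b? : Dec B) → ⌊ a? ⌋ ≡ ⌊ b? ⌋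
⌊⌋-⇔ A⇔B a? b? = trans (isYes≗does a?) (trans (does-⇔ A⇔B a? b?) (sym (isYes≗does b?)))

≟-suc : ∀ m n → ⌊ suc m ≟ suc n ⌋ ≡ ⌊ m ≟ n ⌋
≟-suc m n = ⌊⌋-⇔ (mk⇔ ℕ.suc-injective (cong suc)) (suc m ≟ suc n) (m ≟ n)

sum< : ℕ → (ℕ → ℕ) → ℕ
sum< zero    f = 0
sum< (suc n) f = f 0 + sum< n (f ∘ suc)

sum<-cong : ∀ n {f g : ℕ → ℕ} → (∀ t → t < n → f t ≡ g t) → sum< n f ≡ sum< n g
sum<-cong zero    f≗g = refl
sum<-cong (suc n) f≗g = cong₂ _+_ (f≗g 0 (s≤s z≤n)) (sum<-cong n (λ t t<n → f≗g (suc t) (s≤s t<n)))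

sum<-const : ∀ n x → sum< n (λ _ → x) ≡ n * x
sum<-const zero    x = refl
sum<-const (suc n) x = cong (_+_ x) (sum<-const n x)

sum<-zero : ∀ n {f : ℕ → ℕ} → (∀ t → t < n → f t ≡ 0) → sum< n f ≡ 0
sum<-zero n f≡0 = trans (sum<-cong n f≡0) (trans (sum<-const n 0) (ℕ.*-zeroʳ n))

sum<-distrib-+ : ∀ n (f g : ℕ → ℕ) → sum< n (λ t → f t + g t) ≡ sum< n f + sum< n g
sum<-distrib-+ zero    f g = refl
sum<-distrib-+ (suc n) f g =
  trans (cong (_+_ (f 0 + g 0)) (sum<-distrib-+ n (f ∘ suc) (g ∘ suc)))
        (+-interchange (f 0) (g 0) (sum< n (f ∘ suc)) (sum< n (g ∘ suc)))
  where
  +-interchange : ∀ a b c d → (a + b) + (c + d) ≡ (a + c) + (b + d)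
  +-interchange = solve-∀

sum<-comm : ∀ m n (f : ℕ → ℕ → ℕ) →
  sum< m (λ s → sum< n (f s)) ≡ sum< n (λ t → sum< m (λ s → f s t))
sum<-comm zero    n f = sym (sum<-zero n (λ _ _ → refl))
sum<-comm (suc m) n f =
  trans (cong (_+_ (sum< n (f 0))) (sum<-comm m n (f ∘ suc)))
        (sym (sum<-distrib-+ n (f 0) (λ t → sum< m (λ s → f (suc s) t))))

sum<-mono-≤ : ∀ n {f g : ℕ → ℕ} → (∀ t → t < n → f t ≤ g t) → sum< n f ≤ sum< n g
sum<-mono-≤ zero    f≤g = z≤n
sum<-mono-≤ (suc n) f≤g =
  ℕ.+-mono-≤ (f≤g 0 (s≤s z≤n)) (sum<-mono-≤ n (λ t t<n → f≤g (suc t) (s≤s t<n)))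

sum<-mono-< : ∀ n {f g : ℕ → ℕ} → (∀ t → t < n → f t ≤ g t) →
  ∀ {t} → t < n → f t < g t → sum< n f < sum< n g
sum<-mono-< (suc n) f≤g {zero} _ f<g =
  ℕ.+-mono-<-≤ f<g (sum<-mono-≤ n (λ t t<n → f≤g (suc t) (s≤s t<n)))
sum<-mono-< (suc n) f≤g {suc t} (s≤s t<n) f<g =
  ℕ.+-mono-≤-< (f≤g 0 (s≤s z≤n)) (sum<-mono-< n (λ t t<n → f≤g (suc t) (s≤s t<n)) t<n f<g)

term≤sum< : ∀ n (f : ℕ → ℕ) {t} → t < n → f t ≤ sum< n f
term≤sum< (suc n) f {zero}  _         = ℕ.m≤m+n (f 0) _
term≤sum< (suc n) f {suc t} (s≤s t<n) = ℕ.≤-trans (term≤sum< n (f ∘ suc) t<n) (ℕ.m≤n+m _ (f 0))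

sum<-𝟙-≤1 : ∀ n (P : ℕ → Bool) →
  (∀ {r r'} → r < n → r' < n → T (P r) → T (P r') → r ≡ r') → sum< n (𝟙 ∘ P) ≤ 1
sum<-𝟙-≤1 zero    P unique = z≤n
sum<-𝟙-≤1 (suc n) P unique with P 0 in P0
... | true  = ℕ.≤-reflexive (cong suc (sum<-zero n others))
  where
  others : ∀ t → t < n → 𝟙 (P (suc t)) ≡ 0
  others t t<n with P (suc t) in Pt
  ... | true  = ⊥-elim (ℕ.0≢1+n (unique (s≤s z≤n) (s≤s t<n) (subst T (sym P0) _) (subst T (sym Pt) _)))
  ... | false = refl
... | false = sum<-𝟙-≤1 n (P ∘ suc)
                (λ r<n r'<n Pr Pr' → ℕ.suc-injective (unique (s≤s r<n) (s≤s r'<n) Pr Pr'))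

sum<-saturated : ∀ n {f : ℕ → ℕ} → (∀ t → t < n → f t ≤ 1) → sum< n f ≡ n →
  ∀ t → t < n → f t ≡ 1
sum<-saturated n {f} f≤1 sum≡n t t<n with f t ≟ 1
... | yes ft≡1 = ft≡1
... | no  ft≢1 = ⊥-elim (ℕ.<-irrefl sum≡n·1 (sum<-mono-< n f≤1 t<n (ℕ.≤∧≢⇒< (f≤1 t t<n) ft≢1)))
  where
  sum≡n·1 : sum< n f ≡ sum< n (λ _ → 1)
  sum≡n·1 = trans sum≡n (sym (trans (sum<-const n 1) (ℕ.*-identityʳ n)))

sum<-𝟙-≟ : ∀ e {y} → y < e → sum< e (λ t → 𝟙 ⌊ y ≟ t ⌋) ≡ 1
sum<-𝟙-≟ (suc e) {zero}  _         = cong suc (sum<-zero e (λ _ _ → refl))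
sum<-𝟙-≟ (suc e) {suc y} (s≤s y<e) =
  trans (sum<-cong e (λ t _ → cong 𝟙 (≟-suc y t))) (sum<-𝟙-≟ e y<e)

sum<-𝟙-∧-≟suc : ∀ e u y → (T u → 1 ≤ y × y ≤ e) →
  sum< e (λ t → 𝟙 (u ∧ ⌊ y ≟ suc t ⌋)) ≡ 𝟙 u
sum<-𝟙-∧-≟suc e false y _ = sum<-zero e (λ _ _ → refl)
sum<-𝟙-∧-≟suc e true (suc y) range =
  trans (sum<-cong e (λ t _ → cong 𝟙 (≟-suc y t))) (sum<-𝟙-≟ e (proj₂ (range _)))
sum<-𝟙-∧-≟suc e true zero range with () ← proj₁ (range _)

-- Each fibre holds at most one marked index, and the fibre sizes add up to e.
injective⇒fibres≡1 : ∀ n e (marked : ℕ → Bool) (J : ℕ → ℕ) →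
  sum< n (𝟙 ∘ marked) ≡ e →
  (∀ {r} → r < n → T (marked r) → 1 ≤ J r × J r ≤ e) →
  (∀ {r r'} → r < n → r' < n → T (marked r) → T (marked r') → J r ≡ J r' → r ≡ r') →
  ∀ {j} → 1 ≤ j → j ≤ e → sum< n (λ r → 𝟙 (marked r ∧ ⌊ J r ≟ j ⌋)) ≡ 1
injective⇒fibres≡1 n e marked J count≡e range injective {suc j} _ j<e =
  sum<-saturated e fibre≤1 fibres≡e j j<e
  where
  fibre : ℕ → ℕ
  fibre t = sum< n (λ r → 𝟙 (marked r ∧ ⌊ J r ≟ suc t ⌋))
  fibre≤1 : ∀ t → t < e → fibre t ≤ 1
  fibre≤1 t _ = sum<-𝟙-≤1 n (λ r → marked r ∧ ⌊ J r ≟ suc t ⌋) λ r<n r'<n hit hit' →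
    let (mr , Jr≡) = Equivalence.to T-∧ hit
        (mr' , Jr'≡) = Equivalence.to T-∧ hit'
    in injective r<n r'<n mr mr' (trans (toWitness Jr≡) (sym (toWitness Jr'≡)))
  fibres≡e : sum< e fibre ≡ e
  fibres≡e = trans (sym (sum<-comm n e (λ r t → 𝟙 (marked r ∧ ⌊ J r ≟ suc t ⌋))))
                   (trans (sum<-cong n (λ r r<n → sum<-𝟙-∧-≟suc e (marked r) (J r) (range r<n))) count≡e)

-- Ranks in a decidable total order

module Rank {a ℓ₁ ℓ₂} {A : Set a} {_≈_ : Rel A ℓ₁} {_≼_ : Rel A ℓ₂}
             (order : IsDecTotalOrder _≈_ _≼_) (key : ℕ → A)
             (key-injective : ∀ {i j} → key i ≈ key j → i ≡ j)
             (n : ℕ) (marked : ℕ → Bool) where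

  open IsDecTotalOrder order using (_≤?_; total; antisym) renaming (refl to ≼-refl; trans to ≼-trans)

  rank : ℕ → ℕ
  rank r = sum< n (λ i → 𝟙 (marked i ∧ ⌊ key i ≤? key r ⌋))

  rank-positive : ∀ {r} → r < n → T (marked r) → 1 ≤ rank r
  rank-positive r<n mr =
    ℕ.≤-trans (1≤𝟙 (Equivalence.from T-∧ (mr , fromWitness ≼-refl))) (term≤sum< n _ r<n)

  rank≤count : ∀ r → rank r ≤ sum< n (𝟙 ∘ marked)
  rank≤count r = sum<-mono-≤ n (λ i _ → 𝟙-∧-≤ (marked i) _)

  rank-< : ∀ {r r'} → r' < n → T (marked r') → key r ≼ key r' → ¬ key r' ≼ key r → rank r < rank r'
  rank-< {r} {r'} r'<n mr' r≼r' r'⋠r =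
    sum<-mono-< n (λ i _ → 𝟙-∧-mono (marked i) (λ i≼r → fromWitness (≼-trans (toWitness i≼r) r≼r')))
                r'<n strict
    where
    strict : 𝟙 (marked r' ∧ ⌊ key r' ≤? key r ⌋) < 𝟙 (marked r' ∧ ⌊ key r' ≤? key r' ⌋)
    strict with key r' ≤? key r | key r' ≤? key r'
    ... | yes r'≼r | _        = ⊥-elim (r'⋠r r'≼r)
    ... | no _     | no r'⋠r' = ⊥-elim (r'⋠r' ≼-refl)
    ... | no _     | yes _    = 𝟙-∧-< mr'

  rank-injective : ∀ {r r'} → r < n → r' < n → T (marked r) → T (marked r') →
    rank r ≡ rank r' → r ≡ r'
  rank-injective {r} {r'} r<n r'<n mr mr' same with total (key r) (key r')
  ... | inj₁ r≼r' with key r' ≤? key r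
  ...   | yes r'≼r = key-injective (antisym r≼r' r'≼r)
  ...   | no  r'⋠r = ⊥-elim (ℕ.<-irrefl same (rank-< r'<n mr' r≼r' r'⋠r))
  rank-injective {r} {r'} r<n r'<n mr mr' same | inj₂ r'≼r with key r ≤? key r'
  ...   | yes r≼r' = key-injective (antisym r≼r' r'≼r)
  ...   | no  r⋠r' = ⊥-elim (ℕ.<-irrefl (sym same) (rank-< r<n mr r'≼r r⋠r'))

-- The steps at positions 2i and 2i+1 of a path.
DoubleStep : Set
DoubleStep = Bool × Bool

-- Half the change of height over a double step.
rise : DoubleStep → ℤ
rise (true  , true)  = + 1
rise (true  , false) = + 0
rise (false , true)  = + 0
rise (false , false) = -[1+ 0 ]

heightAfter : ℤ → List DoubleStep → ℤ
heightAfter h []       = h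
heightAfter h (p ∷ ps) = heightAfter (h ℤ.+ rise p) ps

height : List DoubleStep → ℤ
height = heightAfter (+ 0)

walkSum : (ℕ → ℤ → DoubleStep → ℕ) → ℕ → ℤ → List DoubleStep → ℕ
walkSum f i h []       = 0
walkSum f i h (p ∷ ps) = f i h p + walkSum f (suc i) (h ℤ.+ rise p) ps

-- Out-of-range indices return the junk value (true , true).
at : List DoubleStep → ℕ → DoubleStep
at []       _       = true , true
at (p ∷ ps) zero    = p
at (p ∷ ps) (suc r) = at ps r

heightAfter-++ : ∀ h xs ys → heightAfter h (xs ++ ys) ≡ heightAfter (heightAfter h xs) ys
heightAfter-++ h []       ys = refl
heightAfter-++ h (p ∷ xs) ys = heightAfter-++ (h ℤ.+ rise p) xs ys

heightAfter-+ : ∀ g h ps → heightAfter (g ℤ.+ h) ps ≡ g ℤ.+ heightAfter h ps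
heightAfter-+ g h []       = refl
heightAfter-+ g h (p ∷ ps) =
  trans (cong (λ x → heightAfter x ps) (ℤ.+-assoc g h (rise p))) (heightAfter-+ g (h ℤ.+ rise p) ps)

heightAfter≡+height : ∀ g ps → heightAfter g ps ≡ g ℤ.+ height ps
heightAfter≡+height g ps = trans (cong (λ x → heightAfter x ps) (sym (ℤ.+-identityʳ g))) (heightAfter-+ g (+ 0) ps)

height-++ : ∀ xs ys → height (xs ++ ys) ≡ height xs ℤ.+ height ys
height-++ xs ys = trans (heightAfter-++ (+ 0) xs ys) (heightAfter≡+height (height xs) ys)

walkSum-++ : ∀ f i h xs ys →
  walkSum f i h (xs ++ ys) ≡ walkSum f i h xs + walkSum f (i + length xs) (heightAfter h xs) ys
walkSum-++ f i h []       ys = cong (λ k → walkSum f k h ys) (sym (ℕ.+-identityʳ i))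
walkSum-++ f i h (p ∷ xs) ys rewrite walkSum-++ f (suc i) (h ℤ.+ rise p) xs ys | ℕ.+-suc i (length xs) =
  sym (ℕ.+-assoc (f i h p) (walkSum f (suc i) (h ℤ.+ rise p) xs) _)

walkSum-as-sum< : ∀ f i h ps →
  walkSum f i h ps ≡ sum< (length ps) (λ t → f (i + t) (heightAfter h (take t ps)) (at ps t))
walkSum-as-sum< f i h []       = refl
walkSum-as-sum< f i h (p ∷ ps) =
  cong₂ _+_ (cong (λ k → f k h p) (sym (ℕ.+-identityʳ i)))
            (trans (walkSum-as-sum< f (suc i) (h ℤ.+ rise p) ps)
                   (sum<-cong (length ps) (λ t _ → cong (λ k → f k (heightAfter (h ℤ.+ rise p) (take t ps)) (at ps t))
                                                        (sym (ℕ.+-suc i t)))))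

walkSum-cong : ∀ f f' i i' g g' ps →
  (∀ t h p → t < length ps → f (i + t) (g ℤ.+ h) p ≡ f' (i' + t) (g' ℤ.+ h) p) →
  walkSum f i g ps ≡ walkSum f' i' g' ps
walkSum-cong f f' i i' g g' ps agree = begin
  walkSum f i g ps
    ≡⟨ relative f i g ⟩
  sum< (length ps) (λ t → f (i + t) (g ℤ.+ height (take t ps)) (at ps t))
    ≡⟨ sum<-cong (length ps) (λ t → agree t _ _) ⟩
  sum< (length ps) (λ t → f' (i' + t) (g' ℤ.+ height (take t ps)) (at ps t))
    ≡⟨ relative f' i' g' ⟨
  walkSum f' i' g' ps ∎
  where
  open ≡-Reasoning
  relative : ∀ f i g → walkSum f i g ps ≡ sum< (length ps) (λ t → f (i + t) (g ℤ.+ height (take t ps)) (at ps t))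
  relative f i g = trans (walkSum-as-sum< f i g ps)
    (sum<-cong (length ps) (λ t _ → cong (λ x → f (i + t) x (at ps t)) (heightAfter≡+height g (take t ps))))

countᵇ : ∀ {A : Set} → (A → Bool) → List A → ℕ
countᵇ p []       = 0
countᵇ p (x ∷ xs) = 𝟙 (p x) + countᵇ p xs

length-filterᵇ : ∀ {A : Set} (p : A → Bool) xs → length (filterᵇ p xs) ≡ countᵇ p xs
length-filterᵇ p []       = refl
length-filterᵇ p (x ∷ xs) with p x
... | true  = cong suc (length-filterᵇ p xs)
... | false = length-filterᵇ p xs

countᵇ-++ : ∀ {A : Set} (p : A → Bool) xs ys → countᵇ p (xs ++ ys) ≡ countᵇ p xs + countᵇ p ys
countᵇ-++ p []       ys = refl
countᵇ-++ p (x ∷ xs) ys = trans (cong (_+_ (𝟙 (p x))) (countᵇ-++ p xs ys)) (sym (ℕ.+-assoc (𝟙 (p x)) _ _))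

countᵇ-map : ∀ {A B : Set} (p : B → Bool) (f : A → B) xs → countᵇ p (map f xs) ≡ countᵇ (p ∘ f) xs
countᵇ-map p f []       = refl
countᵇ-map p f (x ∷ xs) = cong (_+_ (𝟙 (p (f x)))) (countᵇ-map p f xs)

countᵇ-as-sum< : ∀ (p : DoubleStep → Bool) ps → countᵇ p ps ≡ sum< (length ps) (λ t → 𝟙 (p (at ps t)))
countᵇ-as-sum< p []       = refl
countᵇ-as-sum< p (q ∷ ps) = cong (_+_ (𝟙 (p q))) (countᵇ-as-sum< p ps)

rotate : ℕ → List DoubleStep → List DoubleStep
rotate r ps = drop r ps ++ take r ps

rotate₁ : List DoubleStep → List DoubleStep
rotate₁ []       = []
rotate₁ (p ∷ ps) = ps ++ p ∷ []

drop-at : ∀ r ps → r < length ps → drop r ps ≡ at ps r ∷ drop (suc r) ps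
drop-at zero    (p ∷ ps) _         = refl
drop-at (suc r) (p ∷ ps) (s≤s r<n) = drop-at r ps r<n

take-suc-at : ∀ r ps → r < length ps → take (suc r) ps ≡ take r ps ++ at ps r ∷ []
take-suc-at zero    (p ∷ ps) _         = refl
take-suc-at (suc r) (p ∷ ps) (s≤s r<n) = cong (p ∷_) (take-suc-at r ps r<n)

rotate-at : ∀ r ps → r < length ps → rotate r ps ≡ at ps r ∷ (drop (suc r) ps ++ take r ps)
rotate-at r ps r<n = cong (_++ take r ps) (drop-at r ps r<n)

rotate-suc : ∀ r ps → r < length ps → rotate (suc r) ps ≡ rotate₁ (rotate r ps)
rotate-suc r ps r<n rewrite rotate-at r ps r<n | take-suc-at r ps r<n =
  sym (++-assoc (drop (suc r) ps) (take r ps) (at ps r ∷ []))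

rotate-invariant : ∀ {A : Set} (_∙_ : A → A → A) → (∀ x y → x ∙ y ≡ y ∙ x) →
  (f : List DoubleStep → A) → (∀ xs ys → f (xs ++ ys) ≡ f xs ∙ f ys) →
  ∀ r ps → f (rotate r ps) ≡ f ps
rotate-invariant _∙_ ∙-comm f f-++ r ps = begin
  f (drop r ps ++ take r ps)    ≡⟨ f-++ (drop r ps) (take r ps) ⟩
  f (drop r ps) ∙ f (take r ps) ≡⟨ ∙-comm (f (drop r ps)) (f (take r ps)) ⟩
  f (take r ps) ∙ f (drop r ps) ≡⟨ f-++ (take r ps) (drop r ps) ⟨
  f (take r ps ++ drop r ps)    ≡⟨ cong f (take++drop≡id r ps) ⟩
  f ps                          ∎
  where open ≡-Reasoning

height-rotate : ∀ r ps → height (rotate r ps) ≡ height ps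
height-rotate = rotate-invariant ℤ._+_ ℤ.+-comm height height-++

countᵇ-rotate : ∀ p r ps → countᵇ p (rotate r ps) ≡ countᵇ p ps
countᵇ-rotate p = rotate-invariant _+_ ℕ.+-comm (countᵇ p) (countᵇ-++ p)

Σbool : (Bool → ℕ) → ℕ
Σbool f = f true + f false

ΣDoubleStep : (DoubleStep → ℕ) → ℕ
ΣDoubleStep f = Σbool (λ a → Σbool (λ c → f (a , c)))

Σwords : ℕ → (List DoubleStep → ℕ) → ℕ
Σwords zero    G = G []
Σwords (suc n) G = ΣDoubleStep (λ p → Σwords n (G ∘ (p ∷_)))

ΣDoubleStep-cong : ∀ {f g : DoubleStep → ℕ} → (∀ p → f p ≡ g p) → ΣDoubleStep f ≡ ΣDoubleStep g
ΣDoubleStep-cong f≗g = cong₂ _+_ (cong₂ _+_ (f≗g _) (f≗g _)) (cong₂ _+_ (f≗g _) (f≗g _))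

Σwords-cong : ∀ n {F G : List DoubleStep → ℕ} → (∀ ps → length ps ≡ n → F ps ≡ G ps) →
  Σwords n F ≡ Σwords n G
Σwords-cong zero    F≗G = F≗G [] refl
Σwords-cong (suc n) F≗G = ΣDoubleStep-cong (λ p → Σwords-cong n (λ ps len → F≗G (p ∷ ps) (cong suc len)))

Σwords-distrib-+ : ∀ n (F G : List DoubleStep → ℕ) →
  Σwords n (λ ps → F ps + G ps) ≡ Σwords n F + Σwords n G
Σwords-distrib-+ zero    F G = refl
Σwords-distrib-+ (suc n) F G =
  trans (ΣDoubleStep-cong (λ p → Σwords-distrib-+ n (F ∘ (p ∷_)) (G ∘ (p ∷_))))
        (interchange (Σwords n (F ∘ ((true , true) ∷_))) (Σwords n (G ∘ ((true , true) ∷_)))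
                     (Σwords n (F ∘ ((true , false) ∷_))) (Σwords n (G ∘ ((true , false) ∷_)))
                     (Σwords n (F ∘ ((false , true) ∷_))) (Σwords n (G ∘ ((false , true) ∷_)))
                     (Σwords n (F ∘ ((false , false) ∷_))) (Σwords n (G ∘ ((false , false) ∷_))))
  where
  interchange : ∀ a a' b b' c c' d d' →
    ((a + a') + (b + b')) + ((c + c') + (d + d')) ≡ ((a + b) + (c + d)) + ((a' + b') + (c' + d'))
  interchange = solve-∀

Σwords-zero : ∀ n → Σwords n (λ _ → 0) ≡ 0
Σwords-zero zero    = refl
Σwords-zero (suc n) rewrite Σwords-zero n = refl

Σwords-sum< : ∀ n m (F : ℕ → List DoubleStep → ℕ) →
  Σwords n (λ ps → sum< m (λ r → F r ps)) ≡ sum< m (λ r → Σwords n (F r))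
Σwords-sum< n zero    F = Σwords-zero n
Σwords-sum< n (suc m) F =
  trans (Σwords-distrib-+ n (F 0) (λ ps → sum< m (λ r → F (suc r) ps)))
        (cong (_+_ (Σwords n (F 0))) (Σwords-sum< n m (F ∘ suc)))

Σwords-ΣDoubleStep : ∀ n (F : DoubleStep → List DoubleStep → ℕ) →
  Σwords n (λ ps → ΣDoubleStep (λ p → F p ps)) ≡ ΣDoubleStep (λ p → Σwords n (F p))
Σwords-ΣDoubleStep n F =
  trans (Σwords-distrib-+ n _ _) (cong₂ _+_ (Σwords-distrib-+ n _ _) (Σwords-distrib-+ n _ _))

Σwords-snoc : ∀ n (G : List DoubleStep → ℕ) →
  Σwords (suc n) G ≡ Σwords n (λ ps → ΣDoubleStep (λ p → G (ps ++ p ∷ [])))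
Σwords-snoc zero    G = refl
Σwords-snoc (suc n) G = ΣDoubleStep-cong (λ p → Σwords-snoc n (G ∘ (p ∷_)))

Σwords-rotate₁ : ∀ n (G : List DoubleStep → ℕ) → Σwords n (G ∘ rotate₁) ≡ Σwords n G
Σwords-rotate₁ zero    G = refl
Σwords-rotate₁ (suc n) G =
  sym (trans (Σwords-snoc n G) (Σwords-ΣDoubleStep n (λ p ps → G (ps ++ p ∷ []))))

Σwords-rotate : ∀ n r (G : List DoubleStep → ℕ) → r ≤ n → Σwords n (G ∘ rotate r) ≡ Σwords n G
Σwords-rotate n zero    G _ = Σwords-cong n (λ ps _ → cong G (++-identityʳ ps))
Σwords-rotate n (suc r) G r<n = begin
  Σwords n (G ∘ rotate (suc r))
    ≡⟨ Σwords-cong n (λ ps len → cong G (rotate-suc r ps (subst (r <_) (sym len) r<n))) ⟩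
  Σwords n ((G ∘ rotate₁) ∘ rotate r)
    ≡⟨ Σwords-rotate n r (G ∘ rotate₁) (ℕ.<⇒≤ r<n) ⟩
  Σwords n (G ∘ rotate₁)
    ≡⟨ Σwords-rotate₁ n G ⟩
  Σwords n G ∎
  where open ≡-Reasoning

-- The cycle lemma

is : Bool → Bool → Bool
is b s = ⌊ s Bool.≟ b ⌋

firstIs secondIs : Bool → DoubleStep → Bool
firstIs  b = is b ∘ proj₁
secondIs b = is b ∘ proj₂

-- Defs.countEven read on double steps: the even step is the first component.
evenStep : Bool → Bool → ℕ → ℤ → DoubleStep → ℕ
evenStep b onlyLow _ h p = 𝟙 (firstIs b p ∧ (if onlyLow then h ℤ.≤ᵇ + 0 else true))

count lowCount : Bool → List DoubleStep → ℕ
count    b = countᵇ (firstIs b)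
lowCount b = walkSum (evenStep b true) 0 (+ 0)

walkSum-evenStep-all : ∀ b i h ps → walkSum (evenStep b false) i h ps ≡ count b ps
walkSum-evenStep-all b i h []       = refl
walkSum-evenStep-all b i h (p ∷ ps) =
  cong₂ _+_ (cong 𝟙 (∧-identityʳ (firstIs b p))) (walkSum-evenStep-all b (suc i) (h ℤ.+ rise p) ps)

-- Lexicographic: lower height first, and at equal height the later position first.
_⊑_ : Rel (ℤ × ℕ) _
_⊑_ = ×-Lex _≡_ ℤ._≤_ (flip _≤_)

⊑-isDecTotalOrder : IsDecTotalOrder (Pointwise _≡_ _≡_) _⊑_
⊑-isDecTotalOrder = ×-isDecTotalOrder ℤ.≤-isDecTotalOrder (Flip.isDecTotalOrder ℕ.≤-isDecTotalOrder)

open IsDecTotalOrder ⊑-isDecTotalOrder using () renaming (_≤?_ to _⊑?_)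

⊑-after : ∀ {h i g r} → r ≤ i → (h , i) ⊑ (g , r) ⇔ h ℤ.≤ g
⊑-after {h} {i} {g} {r} r≤i = mk⇔ to from
  where
  to : (h , i) ⊑ (g , r) → h ℤ.≤ g
  to (inj₁ (h≤g , _)) = h≤g
  to (inj₂ (h≡g , _)) = ℤ.≤-reflexive h≡g
  from : h ℤ.≤ g → (h , i) ⊑ (g , r)
  from h≤g with h ℤ.≟ g
  ... | yes h≡g = inj₂ (h≡g , r≤i)
  ... | no  h≢g = inj₁ (h≤g , h≢g)

⊑-before : ∀ {h i g r} → i < r → (h , i) ⊑ (g , r) ⇔ h ℤ.< g
⊑-before {h} {i} {g} {r} i<r = mk⇔ to from
  where
  to : (h , i) ⊑ (g , r) → h ℤ.< g
  to (inj₁ (h≤g , h≢g)) = ℤ.≤∧≢⇒< h≤g h≢g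
  to (inj₂ (_ , r≤i))   = ⊥-elim (ℕ.<⇒≱ i<r r≤i)
  from : h ℤ.< g → (h , i) ⊑ (g , r)
  from h<g = inj₁ (ℤ.<⇒≤ h<g , ℤ.<⇒≢ h<g)

key : List DoubleStep → ℕ → ℤ × ℕ
key ps i = height (take i ps) , i

module KeyRank (b : Bool) (ps : List DoubleStep) =
  Rank ⊑-isDecTotalOrder (key ps) proj₂ (length ps) (firstIs b ∘ at ps)

keyStep : Bool → ℤ × ℕ → ℕ → ℤ → DoubleStep → ℕ
keyStep b k i h p = 𝟙 (firstIs b p ∧ ⌊ (h , i) ⊑? k ⌋)

≤ᵇ≡⌊⌋ : ∀ {x y} {B : Set} → x ℤ.≤ y ⇔ B → (B? : Dec B) → (x ℤ.≤ᵇ y) ≡ ⌊ B? ⌋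
≤ᵇ≡⌊⌋ x≤y⇔B B? =
  trans (does-⇔ (⇔.trans (mk⇔ ℤ.≤ᵇ⇒≤ ℤ.≤⇒≤ᵇ) x≤y⇔B) (T? _) B?) (sym (isYes≗does B?))

≤-translate : ∀ c {x y x' y'} → c ℤ.+ x ≡ x' → c ℤ.+ y ≡ y' → x ℤ.≤ y ⇔ x' ℤ.≤ y'
≤-translate c {x} {y} refl refl = mk⇔ (ℤ.+-monoʳ-≤ c) cancel
  where
  -c+ : ∀ z → ℤ.- c ℤ.+ (c ℤ.+ z) ≡ z
  -c+ z = trans (sym (ℤ.+-assoc (ℤ.- c) c z)) (trans (cong (ℤ._+ z) (ℤ.+-inverseˡ c)) (ℤ.+-identityˡ z))
  cancel : c ℤ.+ x ℤ.≤ c ℤ.+ y → x ℤ.≤ y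
  cancel le = subst₂ ℤ._≤_ (-c+ x) (-c+ y) (ℤ.+-monoʳ-≤ (ℤ.- c) le)

-- Seen from position r, a double step at or after r sits at its height minus g (the height
-- before r), and one before r at one more than that, since the whole word rises by 1; so it is
-- low exactly when its key is ⊑ key r.
lowCount-rotate : ∀ b ps r → r < length ps → height ps ≡ + 1 →
  lowCount b (rotate r ps) ≡ KeyRank.rank b ps r
lowCount-rotate b ps r r<n height≡1 = begin
  walkSum low 0 (+ 0) (D ++ A)
    ≡⟨ walkSum-++ low 0 (+ 0) D A ⟩
  walkSum low 0 (+ 0) D + walkSum low (length D) (height D) A
    ≡⟨ cong₂ _+_ from-r before-r ⟩
  walkSum K r g D + walkSum K 0 (+ 0) A
    ≡⟨ ℕ.+-comm (walkSum K r g D) _ ⟩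
  walkSum K 0 (+ 0) A + walkSum K r g D
    ≡⟨ cong (λ k → walkSum K 0 (+ 0) A + walkSum K k g D) (sym length-A) ⟩
  walkSum K 0 (+ 0) A + walkSum K (length A) g D
    ≡⟨ walkSum-++ K 0 (+ 0) A D ⟨
  walkSum K 0 (+ 0) (A ++ D)
    ≡⟨ cong (walkSum K 0 (+ 0)) (take++drop≡id r ps) ⟩
  walkSum K 0 (+ 0) ps
    ≡⟨ walkSum-as-sum< K 0 (+ 0) ps ⟩
  KeyRank.rank b ps r ∎
  where
  open ≡-Reasoning
  low = evenStep b true
  A = take r ps
  D = drop r ps
  g = height A
  K = keyStep b (key ps r)
  length-A : length A ≡ r
  length-A = trans (length-take r ps) (ℕ.m≤n⇒m⊓n≡m (ℕ.<⇒≤ r<n))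
  g+height-D≡1 : g ℤ.+ height D ≡ + 1
  g+height-D≡1 = trans (sym (height-++ A D)) (trans (cong height (take++drop≡id r ps)) height≡1)
  from-r : walkSum low 0 (+ 0) D ≡ walkSum K r g D
  from-r = walkSum-cong low K 0 r (+ 0) g D λ t h p _ →
    cong (λ x → 𝟙 (firstIs b p ∧ x))
         (≤ᵇ≡⌊⌋ (⇔.trans (≤-translate g (cong (ℤ._+_ g) (ℤ.+-identityˡ h)) (ℤ.+-identityʳ g))
                          (⇔.sym (⊑-after (ℕ.m≤m+n r t))))
                _)
  before-r : walkSum low (length D) (height D) A ≡ walkSum K 0 (+ 0) A
  before-r = walkSum-cong low K (length D) 0 (height D) (+ 0) A λ t h p t<r →
    cong (λ x → 𝟙 (firstIs b p ∧ x))
         (≤ᵇ≡⌊⌋ (⇔.trans (≤-translate g (shift h) (ℤ.+-identityʳ g))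
                 (⇔.trans (mk⇔ ℤ.suc[i]≤j⇒i<j ℤ.i<j⇒suc[i]≤j)
                          (⇔.sym (⊑-before (subst (t <_) length-A t<r)))))
                _)
    where
    shift : ∀ h → g ℤ.+ (height D ℤ.+ h) ≡ + 1 ℤ.+ (+ 0 ℤ.+ h)
    shift h = trans (sym (ℤ.+-assoc g (height D) h))
                    (trans (cong (ℤ._+ h) g+height-D≡1) (cong (ℤ._+_ (+ 1)) (sym (ℤ.+-identityˡ h))))

startsWith : Bool → List DoubleStep → Bool
startsWith b []      = false
startsWith b (p ∷ _) = firstIs b p

counted : Bool → ℕ → ℕ → List DoubleStep → Bool
counted b e j qs =
  ⌊ height qs ℤ.≟ + 1 ⌋ ∧ (startsWith b qs ∧ (⌊ count b qs ≟ e ⌋ ∧ ⌊ lowCount b qs ≟ j ⌋))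

endsAt1With : Bool → ℕ → List DoubleStep → Bool
endsAt1With b e ps = ⌊ height ps ℤ.≟ + 1 ⌋ ∧ ⌊ count b ps ≟ e ⌋

counted-rotate : ∀ b e j ps r → r < length ps →
  counted b e j (rotate r ps) ≡
  ⌊ height ps ℤ.≟ + 1 ⌋ ∧
  (firstIs b (at ps r) ∧ (⌊ count b ps ≟ e ⌋ ∧ ⌊ lowCount b (rotate r ps) ≟ j ⌋))
counted-rotate b e j ps r r<n
  rewrite height-rotate r ps | countᵇ-rotate (firstIs b) r ps | rotate-at r ps r<n = refl

rotations-counted : ∀ b e j ps → 1 ≤ j → j ≤ e →
  sum< (length ps) (λ r → 𝟙 (counted b e j (rotate r ps))) ≡ 𝟙 (endsAt1With b e ps)
rotations-counted b e j ps 1≤j j≤e =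
  trans (sum<-cong n (λ r r<n → cong 𝟙 (counted-rotate b e j ps r r<n))) by-cases
  where
  open KeyRank b ps
  n = length ps
  by-cases : sum< n (λ r → 𝟙 (⌊ height ps ℤ.≟ + 1 ⌋ ∧ (firstIs b (at ps r) ∧
                                (⌊ count b ps ≟ e ⌋ ∧ ⌊ lowCount b (rotate r ps) ≟ j ⌋))))
             ≡ 𝟙 (⌊ height ps ℤ.≟ + 1 ⌋ ∧ ⌊ count b ps ≟ e ⌋)
  by-cases with height ps ℤ.≟ + 1 | count b ps ≟ e
  ... | no _  | _    = sum<-zero n (λ _ _ → refl)
  ... | yes _ | no _ = sum<-zero n (λ r _ → cong 𝟙 (∧-zeroʳ (firstIs b (at ps r))))
  ... | yes height≡1 | yes count≡e =
    trans (sum<-cong n (λ r r<n → cong (λ x → 𝟙 (firstIs b (at ps r) ∧ ⌊ x ≟ j ⌋))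
                                       (lowCount-rotate b ps r r<n height≡1)))
          (injective⇒fibres≡1 n e (firstIs b ∘ at ps) rank marked≡e
             (λ r<n mr → rank-positive r<n mr , subst (rank _ ≤_) marked≡e (rank≤count _))
             rank-injective 1≤j j≤e)
    where
    marked≡e : sum< n (𝟙 ∘ firstIs b ∘ at ps) ≡ e
    marked≡e = trans (sym (countᵇ-as-sum< (firstIs b) ps)) count≡e

rotation-count : ∀ n b e j → 1 ≤ j → j ≤ e →
  n * Σwords n (𝟙 ∘ counted b e j) ≡ Σwords n (𝟙 ∘ endsAt1With b e)
rotation-count n b e j 1≤j j≤e = begin
  n * Σwords n G
    ≡⟨ sum<-const n (Σwords n G) ⟨
  sum< n (λ _ → Σwords n G)
    ≡⟨ sum<-cong n (λ r r<n → Σwords-rotate n r G (ℕ.<⇒≤ r<n)) ⟨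
  sum< n (λ r → Σwords n (G ∘ rotate r))
    ≡⟨ Σwords-sum< n n (λ r → G ∘ rotate r) ⟨
  Σwords n (λ ps → sum< n (λ r → G (rotate r ps)))
    ≡⟨ Σwords-cong n rotations ⟩
  Σwords n (𝟙 ∘ endsAt1With b e) ∎
  where
  open ≡-Reasoning
  G = 𝟙 ∘ counted b e j
  rotations : ∀ ps → length ps ≡ n → sum< n (λ r → G (rotate r ps)) ≡ 𝟙 (endsAt1With b e ps)
  rotations ps len = subst (λ m → sum< m (λ r → G (rotate r ps)) ≡ _) len (rotations-counted b e j ps 1≤j j≤e)

-- Counting words by their two components

Σbits : ℕ → (List Bool → ℕ) → ℕ
Σbits zero    F = F []
Σbits (suc m) F = Σbool (λ a → Σbits m (F ∘ (a ∷_)))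

Σbits-cong : ∀ m {F G : List Bool → ℕ} → (∀ bs → F bs ≡ G bs) → Σbits m F ≡ Σbits m G
Σbits-cong zero    F≗G = F≗G []
Σbits-cong (suc m) F≗G = cong₂ _+_ (Σbits-cong m (F≗G ∘ (true ∷_))) (Σbits-cong m (F≗G ∘ (false ∷_)))

Σbits-zero : ∀ m → Σbits m (λ _ → 0) ≡ 0
Σbits-zero zero    = refl
Σbits-zero (suc m) rewrite Σbits-zero m = refl

Σwords-product : ∀ n (F G : List Bool → ℕ) →
  Σwords n (λ ps → F (map proj₁ ps) * G (map proj₂ ps)) ≡ Σbits n F * Σbits n G
Σwords-product zero    F G = refl
Σwords-product (suc n) F G =
  trans (ΣDoubleStep-cong (λ p → Σwords-product n (F ∘ (proj₁ p ∷_)) (G ∘ (proj₂ p ∷_))))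
        (distrib (Σbits n (F ∘ (true ∷_))) (Σbits n (F ∘ (false ∷_)))
                 (Σbits n (G ∘ (true ∷_))) (Σbits n (G ∘ (false ∷_))))
  where
  distrib : ∀ a b c d → (a * c + a * d) + (b * c + b * d) ≡ (a + b) * (c + d)
  distrib = solve-∀

Σbits-suc-count : ∀ n (c : List Bool → ℕ) → (∀ k → Σbits n (λ bs → 𝟙 ⌊ c bs ≟ k ⌋) ≡ n C k) →
  ∀ k → Σbits n (λ bs → 𝟙 ⌊ suc (c bs) ≟ k ⌋) + Σbits n (λ bs → 𝟙 ⌊ c bs ≟ k ⌋) ≡ suc n C k
Σbits-suc-count n c counts zero    = cong₂ _+_ (Σbits-zero n) (counts 0)
Σbits-suc-count n c counts (suc k) =
  trans (cong₂ _+_ (trans (Σbits-cong n (λ bs → cong 𝟙 (≟-suc (c bs) k))) (counts k)) (counts (suc k)))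
        (nCk+nC[k+1]≡[n+1]C[k+1] n k)

Σbits-count : ∀ α n k → Σbits n (λ bs → 𝟙 ⌊ countᵇ (is α) bs ≟ k ⌋) ≡ n C k
Σbits-count α     zero    zero    = refl
Σbits-count α     zero    (suc k) = refl
Σbits-count true  (suc n) k = Σbits-suc-count n (countᵇ (is true)) (Σbits-count true n) k
Σbits-count false (suc n) k =
  trans (ℕ.+-comm (Σbits n (λ bs → 𝟙 ⌊ countᵇ (is false) bs ≟ k ⌋)) _)
        (Σbits-suc-count n (countᵇ (is false)) (Σbits-count false n) k)

𝟙-∧ : ∀ x y → 𝟙 (x ∧ y) ≡ 𝟙 x * 𝟙 y
𝟙-∧ false y = refl
𝟙-∧ true  y = sym (ℕ.+-identityʳ (𝟙 y))

Σwords-count-count : ∀ n α β x y →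
  Σwords n (λ ps → 𝟙 (⌊ countᵇ (firstIs α) ps ≟ x ⌋ ∧ ⌊ countᵇ (secondIs β) ps ≟ y ⌋))
  ≡ (n C x) * (n C y)
Σwords-count-count n α β x y =
  trans (Σwords-cong n (λ ps _ → split ps))
        (trans (Σwords-product n (count-is α x) (count-is β y))
               (cong₂ _*_ (Σbits-count α n x) (Σbits-count β n y)))
  where
  count-is : Bool → ℕ → List Bool → ℕ
  count-is γ z bs = 𝟙 ⌊ countᵇ (is γ) bs ≟ z ⌋
  split : ∀ ps → 𝟙 (⌊ countᵇ (firstIs α) ps ≟ x ⌋ ∧ ⌊ countᵇ (secondIs β) ps ≟ y ⌋)
                 ≡ count-is α x (map proj₁ ps) * count-is β y (map proj₂ ps)
  split ps = trans (𝟙-∧ ⌊ countᵇ (firstIs α) ps ≟ x ⌋ ⌊ countᵇ (secondIs β) ps ≟ y ⌋)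
                   (sym (cong₂ (λ u v → 𝟙 ⌊ u ≟ x ⌋ * 𝟙 ⌊ v ≟ y ⌋)
                               (countᵇ-map (is α) proj₁ ps) (countᵇ-map (is β) proj₂ ps)))

-- rise (a , c) = [a is up] - [c is down] = [c is up] - [a is down].
heightAfter-balance : (u v : DoubleStep → Bool) → (∀ p → rise p ℤ.+ + 𝟙 (u p) ≡ + 𝟙 (v p)) →
  ∀ g ps → heightAfter g ps ℤ.+ + countᵇ u ps ≡ g ℤ.+ + countᵇ v ps
heightAfter-balance u v step g []       = refl
heightAfter-balance u v step g (p ∷ ps) = begin
  H ℤ.+ + (𝟙 (u p) + countᵇ u ps)
    ≡⟨ cong (ℤ._+_ H) (ℤ.pos-+ (𝟙 (u p)) (countᵇ u ps)) ⟩
  H ℤ.+ (+ 𝟙 (u p) ℤ.+ + countᵇ u ps)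
    ≡⟨ regroup₁ H (+ 𝟙 (u p)) (+ countᵇ u ps) ⟩
  (H ℤ.+ + countᵇ u ps) ℤ.+ + 𝟙 (u p)
    ≡⟨ cong (ℤ._+ + 𝟙 (u p)) (heightAfter-balance u v step (g ℤ.+ rise p) ps) ⟩
  (g ℤ.+ rise p ℤ.+ + countᵇ v ps) ℤ.+ + 𝟙 (u p)
    ≡⟨ regroup₂ g (rise p) (+ countᵇ v ps) (+ 𝟙 (u p)) ⟩
  g ℤ.+ ((rise p ℤ.+ + 𝟙 (u p)) ℤ.+ + countᵇ v ps)
    ≡⟨ cong (λ x → g ℤ.+ (x ℤ.+ + countᵇ v ps)) (step p) ⟩
  g ℤ.+ (+ 𝟙 (v p) ℤ.+ + countᵇ v ps)
    ≡⟨ cong (ℤ._+_ g) (ℤ.pos-+ (𝟙 (v p)) (countᵇ v ps)) ⟨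
  g ℤ.+ + (𝟙 (v p) + countᵇ v ps) ∎
  where
  open ≡-Reasoning
  H = heightAfter (g ℤ.+ rise p) ps
  regroup₁ : ∀ h a c → h ℤ.+ (a ℤ.+ c) ≡ (h ℤ.+ c) ℤ.+ a
  regroup₁ = ℤ-Solver.solve-∀
  regroup₂ : ∀ g r c a → (g ℤ.+ r ℤ.+ c) ℤ.+ a ≡ g ℤ.+ ((r ℤ.+ a) ℤ.+ c)
  regroup₂ = ℤ-Solver.solve-∀

height-balance₁ : ∀ ps → height ps ℤ.+ + countᵇ (secondIs false) ps ≡ + countᵇ (firstIs true) ps
height-balance₁ ps = trans (heightAfter-balance (secondIs false) (firstIs true) step (+ 0) ps) (ℤ.+-identityˡ _)
  where
  step : ∀ p → rise p ℤ.+ + 𝟙 (secondIs false p) ≡ + 𝟙 (firstIs true p)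
  step (true , true) = refl
  step (true , false) = refl
  step (false , true) = refl
  step (false , false) = refl

height-balance₂ : ∀ ps → height ps ℤ.+ + countᵇ (firstIs false) ps ≡ + countᵇ (secondIs true) ps
height-balance₂ ps = trans (heightAfter-balance (firstIs false) (secondIs true) step (+ 0) ps) (ℤ.+-identityˡ _)
  where
  step : ∀ p → rise p ℤ.+ + 𝟙 (firstIs false p) ≡ + 𝟙 (secondIs true p)
  step (true , true) = refl
  step (true , false) = refl
  step (false , true) = refl
  step (false , false) = refl

≡+1⇔ : ∀ z P Q → z ℤ.+ + P ≡ + Q → z ≡ + 1 ⇔ Q ≡ suc P
≡+1⇔ z P Q balance = mk⇔ to from
  where
  add-sub : ∀ z x → z ≡ (z ℤ.+ x) ℤ.- x
  add-sub = ℤ-Solver.solve-∀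
  to : z ≡ + 1 → Q ≡ suc P
  to z≡1 = ℤ.+-injective (trans (sym balance) (cong (λ x → x ℤ.+ + P) z≡1))
  from : Q ≡ suc P → z ≡ + 1
  from Q≡1+P = trans (add-sub z (+ P))
    (trans (cong (λ x → x ℤ.- + P) (trans balance (cong +_ Q≡1+P))) (sym (add-sub (+ 1) (+ P))))

endsAt1With-true : ∀ k ps →
  endsAt1With true (suc k) ps ≡ ⌊ countᵇ (firstIs true) ps ≟ suc k ⌋ ∧ ⌊ countᵇ (secondIs false) ps ≟ k ⌋
endsAt1With-true k ps with countᵇ (firstIs true) ps ≟ suc k
... | no  _     = ∧-zeroʳ _
... | yes Q≡1+k = trans (∧-identityʳ _) (⌊⌋-⇔ (⇔.trans (≡+1⇔ _ _ _ (height-balance₁ ps)) P≡k⇔) _ _)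
  where
  P≡k⇔ : countᵇ (firstIs true) ps ≡ suc (countᵇ (secondIs false) ps) ⇔ countᵇ (secondIs false) ps ≡ k
  P≡k⇔ = mk⇔ (λ Q≡1+P → ℕ.suc-injective (trans (sym Q≡1+P) Q≡1+k))
              (λ P≡k → trans Q≡1+k (cong suc (sym P≡k)))

endsAt1With-false : ∀ e ps →
  endsAt1With false e ps ≡ ⌊ countᵇ (firstIs false) ps ≟ e ⌋ ∧ ⌊ countᵇ (secondIs true) ps ≟ suc e ⌋
endsAt1With-false e ps with countᵇ (firstIs false) ps ≟ e
... | no  _   = ∧-zeroʳ _
... | yes P≡e = trans (∧-identityʳ _) (⌊⌋-⇔ (⇔.trans (≡+1⇔ _ _ _ (height-balance₂ ps)) Q≡1+e⇔) _ _)
  where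
  Q≡1+e⇔ : countᵇ (secondIs true) ps ≡ suc (countᵇ (firstIs false) ps) ⇔ countᵇ (secondIs true) ps ≡ suc e
  Q≡1+e⇔ = mk⇔ (λ Q≡1+P → trans Q≡1+P (cong suc P≡e)) (λ Q≡1+e → trans Q≡1+e (cong suc (sym P≡e)))

Σwords-endsAt1With-true : ∀ n k → Σwords n (𝟙 ∘ endsAt1With true (suc k)) ≡ (n C suc k) * (n C k)
Σwords-endsAt1With-true n k =
  trans (Σwords-cong n (λ ps _ → cong 𝟙 (endsAt1With-true k ps))) (Σwords-count-count n true false (suc k) k)

Σwords-endsAt1With-false : ∀ n e → Σwords n (𝟙 ∘ endsAt1With false e) ≡ (n C e) * (n C suc e)
Σwords-endsAt1With-false n e =
  trans (Σwords-cong n (λ ps _ → cong 𝟙 (endsAt1With-false e ps))) (Σwords-count-count n false true e (suc e))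

C-absorption : ∀ n k → suc k * (suc n C suc k) ≡ suc n * (n C k)
C-absorption zero    zero    = refl
C-absorption zero    (suc k) = ℕ.*-zeroʳ (suc (suc k))
C-absorption (suc n) zero    =
  trans (ℕ.+-identityʳ _) (trans (nC1≡n (suc (suc n))) (sym (ℕ.*-identityʳ (suc (suc n)))))
C-absorption (suc n) (suc k) = begin
  suc (suc k) * (suc (suc n) C suc (suc k))
    ≡⟨ cong (suc (suc k) *_) (nCk+nC[k+1]≡[n+1]C[k+1] (suc n) (suc k)) ⟨
  suc (suc k) * (a + b)
    ≡⟨ spread a b (suc k) ⟩
  a + suc k * a + suc (suc k) * b
    ≡⟨ cong₂ (λ x y → a + x + y) (C-absorption n k) (C-absorption n (suc k)) ⟩
  a + suc n * (n C k) + suc n * (n C suc k)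
    ≡⟨ collect a (n C k) (n C suc k) (suc n) ⟩
  a + suc n * ((n C k) + (n C suc k))
    ≡⟨ cong (λ x → a + suc n * x) (nCk+nC[k+1]≡[n+1]C[k+1] n k) ⟩
  suc (suc n) * a
    ∎
  where
  open ≡-Reasoning
  a = suc n C suc k
  b = suc n C suc (suc k)
  spread : ∀ a b k → suc k * (a + b) ≡ a + k * a + suc k * b
  spread = solve-∀
  collect : ∀ a x y m → a + m * x + m * y ≡ a + m * (x + y)
  collect = solve-∀

C-absorption-* : ∀ n k m → suc k * ((suc n C suc k) * m) ≡ suc n * ((n C k) * m)
C-absorption-* n k m =
  trans (sym (ℕ.*-assoc (suc k) (suc n C suc k) m))
        (trans (cong (_* m) (C-absorption n k)) (ℕ.*-assoc (suc n) (n C k) m))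

-- From paths to words of double steps

endHeightL : ℤ → List Bool → ℤ
endHeightL h []       = h
endHeightL h (s ∷ xs) = endHeightL (h ℤ.+ stepℤ s) xs

countEvenL : Bool → Bool → ℕ → ℤ → List Bool → ℕ
countEvenL b onlyLow pos h []       = 0
countEvenL b onlyLow pos h (s ∷ xs) =
  𝟙 (⌊ s Bool.≟ b ⌋ ∧ isEven pos ∧ (if onlyLow then h ℤ.≤ᵇ + 0 else true))
  + countEvenL b onlyLow (suc pos) (h ℤ.+ stepℤ s) xs

endHeight-toList : ∀ {m} h (v : Vec Bool m) → endHeight h v ≡ endHeightL h (toList v)
endHeight-toList h []       = refl
endHeight-toList h (s ∷ v) = endHeight-toList (h ℤ.+ stepℤ s) v

countEven-toList : ∀ {m} b onlyLow pos h (v : Vec Bool m) →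
  countEven b onlyLow pos h v ≡ countEvenL b onlyLow pos h (toList v)
countEven-toList b onlyLow pos h []      = refl
countEven-toList b onlyLow pos h (s ∷ v) =
  cong (_+_ (𝟙 (⌊ s Bool.≟ b ⌋ ∧ isEven pos ∧ (if onlyLow then h ℤ.≤ᵇ + 0 else true))))
       (countEven-toList b onlyLow (suc pos) (h ℤ.+ stepℤ s) v)

pathCondition : Bool → ℕ → ℕ → List Bool → Bool
pathCondition b e j []       = false
pathCondition b e j (s ∷ xs) =
  ⌊ endHeightL (+ 0) (s ∷ xs) ℤ.≟ + 2 ⌋ ∧ (⌊ s Bool.≟ b ⌋ ∧
    (⌊ countEvenL b false 0 (+ 0) (s ∷ xs) ≟ e ⌋ ∧ ⌊ countEvenL b true 0 (+ 0) (s ∷ xs) ≟ j ⌋))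

pathCondition-toList : ∀ {m} b e j s (v : Vec Bool m) →
  (⌊ endHeight (+ 0) (s ∷ v) ℤ.≟ + 2 ⌋ ∧ (⌊ s Bool.≟ b ⌋ ∧
    (⌊ evenSteps b (s ∷ v) ≟ e ⌋ ∧ ⌊ evenStepsLow b (s ∷ v) ≟ j ⌋)))
  ≡ pathCondition b e j (toList (s ∷ v))
pathCondition-toList b e j s v
  rewrite endHeight-toList (+ 0) (s ∷ v)
        | countEven-toList b false 0 (+ 0) (s ∷ v) | countEven-toList b true 0 (+ 0) (s ∷ v) = refl

length-filter-allWords : ∀ m (P : Vec Bool m → Bool) (F : List Bool → Bool) →
  (∀ v → P v ≡ F (toList v)) → length (filterᵇ P (allWords m)) ≡ Σbits m (𝟙 ∘ F)
length-filter-allWords m P F agree = trans (length-filterᵇ P (allWords m)) (count-allWords m P F agree)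
  where
  count-allWords : ∀ m (P : Vec Bool m → Bool) (F : List Bool → Bool) →
    (∀ v → P v ≡ F (toList v)) → countᵇ P (allWords m) ≡ Σbits m (𝟙 ∘ F)
  count-allWords zero    P F agree = trans (ℕ.+-identityʳ _) (cong 𝟙 (agree []))
  count-allWords (suc m) P F agree =
    trans (countᵇ-++ P (map (true ∷_) (allWords m)) (map (false ∷_) (allWords m)))
          (cong₂ _+_ (trans (countᵇ-map P (true ∷_) (allWords m))
                            (count-allWords m (P ∘ (true ∷_)) (F ∘ (true ∷_)) (agree ∘ (true ∷_))))
                     (trans (countᵇ-map P (false ∷_) (allWords m))
                            (count-allWords m (P ∘ (false ∷_)) (F ∘ (false ∷_)) (agree ∘ (false ∷_)))))

unpair : List DoubleStep → List Bool
unpair []       = []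
unpair (p ∷ ps) = proj₁ p ∷ proj₂ p ∷ unpair ps

Σbits-unpair : ∀ n (F : List Bool → ℕ) → Σbits (2 * n) F ≡ Σwords n (F ∘ unpair)
Σbits-unpair zero    F = refl
Σbits-unpair (suc n) F =
  trans (cong (λ m → Σbits m F) (ℕ.*-suc 2 n))
        (ΣDoubleStep-cong (λ p → Σbits-unpair n (λ xs → F (proj₁ p ∷ proj₂ p ∷ xs))))

steps≡rise+rise : ∀ p → stepℤ (proj₁ p) ℤ.+ stepℤ (proj₂ p) ≡ rise p ℤ.+ rise p
steps≡rise+rise (true , true)   = refl
steps≡rise+rise (true , false)  = refl
steps≡rise+rise (false , true)  = refl
steps≡rise+rise (false , false) = refl

double-step : ∀ g p →
  (g ℤ.+ g) ℤ.+ stepℤ (proj₁ p) ℤ.+ stepℤ (proj₂ p) ≡ (g ℤ.+ rise p) ℤ.+ (g ℤ.+ rise p)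
double-step g p =
  trans (ℤ.+-assoc (g ℤ.+ g) _ _) (trans (cong (ℤ._+_ (g ℤ.+ g)) (steps≡rise+rise p)) (interchange g (rise p)))
  where
  interchange : ∀ g r → (g ℤ.+ g) ℤ.+ (r ℤ.+ r) ≡ (g ℤ.+ r) ℤ.+ (g ℤ.+ r)
  interchange = ℤ-Solver.solve-∀

endHeightL-unpair : ∀ g ps → endHeightL (g ℤ.+ g) (unpair ps) ≡ heightAfter g ps ℤ.+ heightAfter g ps
endHeightL-unpair g []       = refl
endHeightL-unpair g (p ∷ ps) =
  trans (cong (λ h → endHeightL h (unpair ps)) (double-step g p)) (endHeightL-unpair (g ℤ.+ rise p) ps)

double-≤ᵇ0 : ∀ g → ((g ℤ.+ g) ℤ.≤ᵇ + 0) ≡ (g ℤ.≤ᵇ + 0)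
double-≤ᵇ0 (+ zero)  = refl
double-≤ᵇ0 (+ suc m) = refl
double-≤ᵇ0 -[1+ m ]  = refl

-- Only the first step of a double step sits at an even position.
countEvenL-unpair : ∀ b onlyLow pos g i ps → isEven pos ≡ true →
  countEvenL b onlyLow pos (g ℤ.+ g) (unpair ps) ≡ walkSum (evenStep b onlyLow) i g ps
countEvenL-unpair b onlyLow pos g i []       _        = refl
countEvenL-unpair b onlyLow pos g i (p ∷ ps) pos-even
  rewrite pos-even | ∧-zeroʳ ⌊ proj₂ p Bool.≟ b ⌋ | double-step g p =
  cong₂ _+_ (cong (λ x → 𝟙 (firstIs b p ∧ x)) (low onlyLow))
            (countEvenL-unpair b onlyLow (suc (suc pos)) (g ℤ.+ rise p) (suc i) ps
                               (cong (λ x → not (not x)) pos-even))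
  where
  low : ∀ onlyLow →
    (if onlyLow then (g ℤ.+ g) ℤ.≤ᵇ + 0 else true) ≡ (if onlyLow then g ℤ.≤ᵇ + 0 else true)
  low true  = double-≤ᵇ0 g
  low false = refl

double-≟2 : ∀ g → ⌊ (g ℤ.+ g) ℤ.≟ + 2 ⌋ ≡ ⌊ g ℤ.≟ + 1 ⌋
double-≟2 g =
  ⌊⌋-⇔ (mk⇔ (λ eq → ℤ.*-cancelˡ-≡ (+ 2) g (+ 1) (trans (double g) eq)) (λ { refl → refl })) _ _
  where
  double : ∀ g → + 2 ℤ.* g ≡ g ℤ.+ g
  double = ℤ-Solver.solve-∀

pathCondition-unpair : ∀ b e j ps → pathCondition b e j (unpair ps) ≡ counted b e j ps
pathCondition-unpair b e j []       = refl
pathCondition-unpair b e j (p ∷ ps)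
  rewrite endHeightL-unpair (+ 0) (p ∷ ps) | double-≟2 (height (p ∷ ps))
        | countEvenL-unpair b false 0 (+ 0) 0 (p ∷ ps) refl | countEvenL-unpair b true 0 (+ 0) 0 (p ∷ ps) refl
        | walkSum-evenStep-all b 0 (+ 0) (p ∷ ps) = refl

countPaths≡Σwords : ∀ n b e j → countPaths (suc n) b e j ≡ Σwords (suc n) (𝟙 ∘ counted b e j)
countPaths≡Σwords n b e j =
  trans (length-filter-allWords (2 * suc n) _ (pathCondition b e j) (λ { (s ∷ v) → pathCondition-toList b e j s v }))
        (trans (Σbits-unpair (suc n) (𝟙 ∘ pathCondition b e j))
               (Σwords-cong (suc n) (λ ps _ → cong 𝟙 (pathCondition-unpair b e j ps))))

*-cancel-via : ∀ N k c a x .{{_ : NonZero N}} → N * c ≡ a → k * a ≡ N * x → k * c ≡ x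
*-cancel-via N k c a x Nc≡a ka≡Nx = ℕ.*-cancelˡ-≡ (k * c) x N (begin
  N * (k * c) ≡⟨ x∙yz≈y∙xz N k c ⟩
  k * (N * c) ≡⟨ cong (k *_) Nc≡a ⟩
  k * a       ≡⟨ ka≡Nx ⟩
  N * x       ∎)
  where open ≡-Reasoning

theorem12 : (n : ℕ) → 1 ≤ n →
    ((k j : ℕ) → 1 < k → 1 ≤ j → j ≤ k ∸ 1 →
      (k ∸ 1) * countPaths n false (k ∸ 1) j ≡ (n C k) * ((n ∸ 1) C (k ∸ 2)))
    ×
    ((k j : ℕ) → 1 ≤ k → 1 ≤ j → j ≤ k →
      k * countPaths n true k j ≡ ((n ∸ 1) C (k ∸ 1)) * (n C (k ∸ 1)))
theorem12 (suc n) _ = part₁ , part₂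
  where
  N = suc n
  N*countPaths : ∀ b e j → 1 ≤ j → j ≤ e → N * countPaths N b e j ≡ Σwords N (𝟙 ∘ endsAt1With b e)
  N*countPaths b e j 1≤j j≤e = trans (cong (N *_) (countPaths≡Σwords n b e j)) (rotation-count N b e j 1≤j j≤e)
  part₁ : (k j : ℕ) → 1 < k → 1 ≤ j → j ≤ k ∸ 1 →
    (k ∸ 1) * countPaths N false (k ∸ 1) j ≡ (N C k) * (n C (k ∸ 2))
  part₁ (suc zero)    j (s≤s ())
  part₁ (suc (suc k)) j _ 1≤j j≤e = *-cancel-via N (suc k) _ _ _
    (trans (N*countPaths false (suc k) j 1≤j j≤e) (Σwords-endsAt1With-false N (suc k)))
    (trans (C-absorption-* n k (N C suc (suc k))) (cong (N *_) (ℕ.*-comm (n C k) (N C suc (suc k)))))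
  part₂ : (k j : ℕ) → 1 ≤ k → 1 ≤ j → j ≤ k →
    k * countPaths N true k j ≡ (n C (k ∸ 1)) * (N C (k ∸ 1))
  part₂ (suc k) j _ 1≤j j≤k = *-cancel-via N (suc k) _ _ _
    (trans (N*countPaths true (suc k) j 1≤j j≤k) (Σwords-endsAt1With-true N k))
    (C-absorption-* n k (N C k))
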